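{- Let $\alpha,\beta,\mu,\nu$ be partitions with $\alpha\subseteq\mu$ and $\beta\subseteq\nu$. Then $\lambda(\alpha,\beta)\subseteq\lambda(\mu,\nu)$ and $\rho(\alpha,\beta)\subseteq\rho(\mu,\nu)$.
   Context: Partitions are weakly decreasing sequences of nonnegative integers, identified up to trailing zeros; $\alpha\subseteq\mu$ means $\alpha_i\le\mu_i$ for all $i$ (inclusion of diagrams). For partitions $\mu,\nu$ written as $n$-tuples ($n\ge$ the number of nonzero parts of each), the $*$-operation is $(\mu,\nu)^*=(\lambda(\mu,\nu),\rho(\mu,\nu))$ with $\lambda_k=\mu_k-k+\#\{j\in\{1,\dots,n\}: \nu_j-j\ge \mu_k-k\}$ and $\rho_j=\nu_j-j+1+\#\{k\in\{1,\dots,n\}:\mu_k-k>\nu_j-j\}$. -}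

module Defs where

open import Data.Nat as ℕ using (ℕ; suc)
open import Data.Integer as ℤ using (ℤ; +_; _-_; _+_; _≤_; _<_)
import Data.Integer.Properties as ℤP
open import Data.Fin using (Fin; toℕ)
import Data.Fin as F
open import Data.List using (List; length; filter)
open import Data.List.Base using (allFin)
open import Data.Vec.Functional using (Vector)

-- A partition written as an n-tuple (μ_1, …, μ_n): a weakly decreasing
-- sequence of n nonnegative integers.  Index i : Fin n stands for position toℕ i + 1.
IsPartition : {n : ℕ} → Vector ℕ n → Set
IsPartition {n} μ = ∀ (i j : Fin n) → i F.≤ j → μ j ℕ.≤ μ i

pos : {n : ℕ} → Fin n → ℤ
pos i = + suc (toℕ i)

shifted : {n : ℕ} → Vector ℕ n → Fin n → ℤ
shifted μ k = + μ k - pos k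

lam : {n : ℕ} → Vector ℕ n → Vector ℕ n → Vector ℤ n
lam {n} μ ν k =
  shifted μ k + + length (filter (λ j → shifted μ k ℤP.≤? shifted ν j) (allFin n))

rho : {n : ℕ} → Vector ℕ n → Vector ℕ n → Vector ℤ n
rho {n} μ ν j =
  shifted ν j + + 1 + + length (filter (λ k → shifted ν j ℤP.<? shifted μ k) (allFin n))

_⊆ᴾ_ : {n : ℕ} → Vector ℕ n → Vector ℕ n → Set
_⊆ᴾ_ {n} α μ = ∀ (i : Fin n) → α i ℕ.≤ μ i

_⊆ᶻ_ : {n : ℕ} → Vector ℤ n → Vector ℤ n → Set
_⊆ᶻ_ {n} a b = ∀ (i : Fin n) → a i ≤ b i

-- Write F_b(x) = x + #{j : x ≤ b_j} (plusCount≥ below).  Then λ_k(μ,ν) = F_b(μ_k − k)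
-- with b_j = ν_j − j, and ρ_j(μ,ν) = F_a(ν_j − j + 1) with a_k = μ_k − k.  F_b(x) is
-- monotone in b, since raising the b_j only enlarges the counted set, and monotone in x
-- when the b_j are distinct, since then raising x by one drops at most one j from the
-- count.  The contents μ_k − k of a partition are strictly decreasing, hence distinct,
-- and α ⊆ μ raises every content.
module Submission where

open import Defs
open import Data.Nat as ℕ using (ℕ; zero; suc; z≤n; s≤s)
open import Data.Product using (_×_; _,_)
open import Data.Vec.Functional using (Vector)
open import Data.Integer as ℤ using (ℤ; +_; -_; 1ℤ; ∣_∣; _≤_; _<_; +≤+; +<+)
  renaming (suc to sucℤ)
open import Data.Integer.Properties
import Data.Nat.Properties as ℕ
open import Algebra.Properties.AbelianGroup +-0-abelianGroup using (//-rightDividesˡ)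
import Data.Fin as Fin
import Data.Fin.Properties as Fin
open import Data.List using (List; _∷_; length; filter; allFin)
open import Data.List.Properties using (filter-≐)
open import Data.List.Relation.Unary.All as All using (All; []; _∷_)
open import Data.List.Relation.Unary.AllPairs as AllPairs using (AllPairs; []; _∷_)
open import Data.List.Relation.Unary.Unique.Propositional.Properties using (allFin⁺)
open import Function using (_∘_; Injective)
open import Relation.Binary using (tri<; tri≈; tri>)
open import Relation.Binary.PropositionalEquality
open import Relation.Nullary using (yes; no; contradiction)
open import Relation.Unary using (Pred; Decidable)

length-filter-mono : ∀ {a p q} {A : Set a} {P : Pred A p} {Q : Pred A q}
                     (P? : Decidable P) (Q? : Decidable Q) {xs : List A} →
                     All (λ x → P x → Q x) xs → length (filter P? xs) ℕ.≤ length (filter Q? xs)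
length-filter-mono P? Q? [] = z≤n
length-filter-mono P? Q? {x ∷ xs} (P⇒Q ∷ P⇒Qs) with P? x | Q? x
... | yes _  | yes _   = s≤s (length-filter-mono P? Q? P⇒Qs)
... | no _   | yes _   = ℕ.m≤n⇒m≤1+n (length-filter-mono P? Q? P⇒Qs)
... | no _   | no _    = length-filter-mono P? Q? P⇒Qs
... | yes px | no ¬qx  = contradiction (P⇒Q px) ¬qx

≤-suc⇒monotone : (f : ℤ → ℤ) → (∀ x → f x ≤ f (sucℤ x)) → ∀ {x y} → x ≤ y → f x ≤ f y
≤-suc⇒monotone f step {x} {y} x≤y = subst (λ z → f x ≤ f z) d+x≡y (f-mono-+ ∣ x ℤ.- y ∣)
  where
  f-mono-+ : ∀ d → f x ≤ f (+ d ℤ.+ x)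
  f-mono-+ zero    = ≤-reflexive (cong f (sym (+-identityˡ x)))
  f-mono-+ (suc d) = ≤-trans (f-mono-+ d)
    (subst (λ z → f (+ d ℤ.+ x) ≤ f z) (sym (+-assoc 1ℤ (+ d) x)) (step (+ d ℤ.+ x)))

  d+x≡y : + ∣ x ℤ.- y ∣ ℤ.+ x ≡ y
  d+x≡y = trans (cong (ℤ._+ x) (∣-∣-≤ x≤y)) (//-rightDividesˡ x y)

module _ {A : Set} where

  count≥ : (A → ℤ) → ℤ → List A → ℕ
  count≥ b x xs = length (filter (λ j → x ≤? b j) xs)

  plusCount≥ : (A → ℤ) → List A → ℤ → ℤ
  plusCount≥ b xs x = x ℤ.+ + count≥ b x xs

  count≥-mono : ∀ {b b′ : A → ℤ} → (∀ j → b j ≤ b′ j) → ∀ x xs →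
                count≥ b x xs ℕ.≤ count≥ b′ x xs
  count≥-mono b≤b′ x xs =
    length-filter-mono _ _ (All.universal (λ j x≤bj → ≤-trans x≤bj (b≤b′ j)) xs)

  absent⇒count≥-≤-count≥-suc : ∀ (b : A → ℤ) x xs → All (λ j → b j ≢ x) xs →
                  count≥ b x xs ℕ.≤ count≥ b (sucℤ x) xs
  absent⇒count≥-≤-count≥-suc b x xs b≢x =
    length-filter-mono _ _ (All.map (λ bj≢x x≤bj → i<j⇒suc[i]≤j (≤∧≢⇒< x≤bj (bj≢x ∘ sym))) b≢x)

  count≥-≤-suc : ∀ (b : A → ℤ) x {xs} → AllPairs (λ i j → b i ≢ b j) xs →
                 count≥ b x xs ℕ.≤ suc (count≥ b (sucℤ x) xs)
  count≥-≤-suc b x [] = z≤n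
  count≥-≤-suc b x {j ∷ xs} (bj≢ ∷ distinct) with x ≤? b j | sucℤ x ≤? b j
  ... | yes _    | yes _     = s≤s (count≥-≤-suc b x distinct)
  ... | no _     | no _      = count≥-≤-suc b x distinct
  ... | no x≰bj  | yes x<bj  = contradiction (≤-trans (i≤suc[i] x) x<bj) x≰bj
  ... | yes x≤bj | no x≮bj   = s≤s (absent⇒count≥-≤-count≥-suc b x xs
                                  (All.map (λ bj≢bk bk≡x → bj≢bk (trans bj≡x (sym bk≡x))) bj≢))
    where
    bj≡x : b j ≡ x
    bj≡x = ≤-antisym (≮⇒≥ (x≮bj ∘ i<j⇒suc[i]≤j)) x≤bj

  plusCount≥-monoˡ : ∀ {b b′ : A → ℤ} → (∀ j → b j ≤ b′ j) → ∀ xs x →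
                     plusCount≥ b xs x ≤ plusCount≥ b′ xs x
  plusCount≥-monoˡ b≤b′ xs x = +-monoʳ-≤ x (+≤+ (count≥-mono b≤b′ x xs))

  plusCount≥-≤-suc : ∀ (b : A → ℤ) {xs} → AllPairs (λ i j → b i ≢ b j) xs → ∀ x →
                     plusCount≥ b xs x ≤ plusCount≥ b xs (sucℤ x)
  plusCount≥-≤-suc b {xs} distinct x = begin
    x ℤ.+ + count≥ b x xs                     ≤⟨ +-monoʳ-≤ x (+≤+ (count≥-≤-suc b x distinct)) ⟩
    x ℤ.+ (1ℤ ℤ.+ + count≥ b (sucℤ x) xs)     ≡⟨ +-assoc x 1ℤ _ ⟨
    x ℤ.+ 1ℤ ℤ.+ + count≥ b (sucℤ x) xs       ≡⟨ cong (ℤ._+ + count≥ b (sucℤ x) xs) (+-comm x 1ℤ) ⟩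
    sucℤ x ℤ.+ + count≥ b (sucℤ x) xs         ∎
    where open ≤-Reasoning

  plusCount≥-monoʳ : ∀ (b : A → ℤ) {xs} → AllPairs (λ i j → b i ≢ b j) xs → ∀ {x y} →
                     x ≤ y → plusCount≥ b xs x ≤ plusCount≥ b xs y
  plusCount≥-monoʳ b distinct = ≤-suc⇒monotone _ (plusCount≥-≤-suc b distinct)

module _ {n : ℕ} where

  shifted-mono : ∀ {α μ : Vector ℕ n} → α ⊆ᴾ μ → ∀ i → shifted α i ≤ shifted μ i
  shifted-mono α⊆μ i = +-monoˡ-≤ (- pos i) (+≤+ (α⊆μ i))

  shifted-strictlyDecreasing : ∀ {μ : Vector ℕ n} → IsPartition μ → ∀ {i j} →
                               i Fin.< j → shifted μ j < shifted μ i
  shifted-strictlyDecreasing μ-part {i} {j} i<j =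
    +-mono-≤-< (+≤+ (μ-part i j (ℕ.<⇒≤ i<j))) (neg-mono-< (+<+ (s≤s i<j)))

  shifted-injective : ∀ {μ : Vector ℕ n} → IsPartition μ → Injective _≡_ _≡_ (shifted μ)
  shifted-injective μ-part {i} {j} eq with Fin.<-cmp i j
  ... | tri< i<j _ _ = contradiction (sym eq) (<⇒≢ (shifted-strictlyDecreasing μ-part i<j))
  ... | tri≈ _ i≡j _ = i≡j
  ... | tri> _ _ j<i = contradiction eq (<⇒≢ (shifted-strictlyDecreasing μ-part j<i))

  shifted-distinct : ∀ {μ : Vector ℕ n} → IsPartition μ →
                     AllPairs (λ i j → shifted μ i ≢ shifted μ j) (allFin n)
  shifted-distinct μ-part = AllPairs.map (_∘ shifted-injective μ-part) (allFin⁺ n)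

  rho≡plusCount≥ : ∀ (μ ν : Vector ℕ n) j →
                   rho μ ν j ≡ plusCount≥ (shifted μ) (allFin n) (sucℤ (shifted ν j))
  rho≡plusCount≥ μ ν j = cong₂ (λ s c → s ℤ.+ + c) (+-comm (shifted ν j) 1ℤ)
    (cong length (filter-≐ _ _ (i<j⇒suc[i]≤j , suc[i]≤j⇒i<j) (allFin n)))

lemma2p6 : (n : ℕ) (α β μ ν : Vector ℕ n) →
    IsPartition α → IsPartition β → IsPartition μ → IsPartition ν →
    α ⊆ᴾ μ → β ⊆ᴾ ν →
    (lam α β ⊆ᶻ lam μ ν) × (rho α β ⊆ᶻ rho μ ν)
-- Only the contents of μ and ν have to be distinct, so α and β need not be partitions.
lemma2p6 n α β μ ν _ _ μ-part ν-part α⊆μ β⊆ν = lam-mono , rho-mono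
  where
  open ≤-Reasoning

  lam-mono : lam α β ⊆ᶻ lam μ ν
  lam-mono k = begin
    plusCount≥ (shifted β) (allFin n) (shifted α k)
      ≤⟨ plusCount≥-monoˡ (shifted-mono β⊆ν) (allFin n) (shifted α k) ⟩
    plusCount≥ (shifted ν) (allFin n) (shifted α k)
      ≤⟨ plusCount≥-monoʳ (shifted ν) (shifted-distinct ν-part) (shifted-mono α⊆μ k) ⟩
    plusCount≥ (shifted ν) (allFin n) (shifted μ k) ∎

  rho-mono : rho α β ⊆ᶻ rho μ ν
  rho-mono j = begin
    rho α β j
      ≡⟨ rho≡plusCount≥ α β j ⟩
    plusCount≥ (shifted α) (allFin n) (sucℤ (shifted β j))
      ≤⟨ plusCount≥-monoˡ (shifted-mono α⊆μ) (allFin n) (sucℤ (shifted β j)) ⟩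
    plusCount≥ (shifted μ) (allFin n) (sucℤ (shifted β j))
      ≤⟨ plusCount≥-monoʳ (shifted μ) (shifted-distinct μ-part) (suc-mono (shifted-mono β⊆ν j)) ⟩
    plusCount≥ (shifted μ) (allFin n) (sucℤ (shifted ν j))
      ≡⟨ rho≡plusCount≥ μ ν j ⟨
    rho μ ν j ∎
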